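{- (a) Let $\langle K,R,\vDash\rangle$ be a Kripke model such that for every $k\in K$: the restriction of $R$ to $R^+[k]$ is transitive (for all $x,y,z\in R^+[k]$, $xRy$ and $yRz$ imply $xRz$), and $\vDash$ restricted to $R^{++}[k]$ is formula persistent (for all $x,y\in R^{++}[k]$ with $xRy$ and every formula $\chi$, $x\vDash\chi$ implies $y\vDash\chi$). Then for all formulas $\varphi,\psi,\theta$, the formula $[(\varphi\&\psi)\rightarrow\theta]\rightarrow[\varphi\rightarrow(\psi\rightarrow\theta)]$ holds at every node of this model. (b) Conversely, suppose the axiom scheme $[(\varphi\&\psi)\rightarrow\theta]\rightarrow[\varphi\rightarrow(\psi\rightarrow\theta)]$ is satisfied in a Kripke frame $\langle K,R\rangle$ (every instance holds at every node of every Kripke model on the frame). Then for every $k\in K$ the restriction of $R$ to $R^+[k]$ is transitive; and every Kripke model on this frame in which that scheme holds at every node has a satisfaction relation whose restriction to $R^{++}[k]$ is formula persistent for every $k\in K$.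
   Context: Formulas are built from a countably infinite set of atoms and the constant $\bot$ (falsity) using the binary connectives $\&$ and $\rightarrow$. A Kripke frame is a pair $\langle K,R\rangle$ with $R\subseteq K\times K$ an arbitrary binary relation; a Kripke model on it is $\langle K,R,\vDash\rangle$ with $\vDash\subseteq K\times\mathsf{Atoms}$ arbitrary, extended to formulas by: $k\nvDash\bot$; $k\vDash\varphi\&\psi$ iff $k\vDash\varphi$ and $k\vDash\psi$; $k\vDash\varphi\rightarrow\psi$ iff for every $k'$ with $kRk'$, if $k'\vDash\varphi$ then $k'\vDash\psi$. For $k\in K$, $R^n[k]=\{x\mid \exists y_1,\dots,y_{n-1}\,(kRy_1R\cdots Ry_{n-1}Rx)\}$, $R^+[k]=\bigcup_{n\ge1}R^n[k]$ and $R^{++}[k]=\bigcup_{n\ge2}R^n[k]$. -}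

module Defs where

open import Data.Nat using (ℕ)
open import Data.Product using (Σ; _×_; ∃)
open import Data.Empty using (⊥)

data Form : Set where
  atom : ℕ → Form
  fls  : Form
  _&_  : Form → Form → Form
  _⇒_  : Form → Form → Form

infixr 6 _&_
infixr 5 _⇒_

record Frame : Set₁ where
  field
    K : Set
    R : K → K → Set

Valuation : Frame → Set₁
Valuation F = Frame.K F → ℕ → Set

module _ (F : Frame) (V : Valuation F) where
  open Frame F
  Sat : K → Form → Set
  Sat k (atom p) = V k p
  Sat k fls      = ⊥
  Sat k (φ & ψ)  = Sat k φ × Sat k ψ
  Sat k (φ ⇒ ψ)  = ∀ k' → R k k' → Sat k' φ → Sat k' ψ

module _ (F : Frame) where
  open Frame F

  data R⁺ (k : K) : K → Set where
    step : ∀ {x} → R k x → R⁺ k x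
    more : ∀ {y x} → R⁺ k y → R y x → R⁺ k x

  R⁺⁺ : K → K → Set
  R⁺⁺ k x = Σ K (λ y → R⁺ k y × R y x)

  TransOn⁺ : K → Set
  TransOn⁺ k = ∀ x y z → R⁺ k x → R⁺ k y → R⁺ k z → R x y → R y z → R x z

  PersistentOn⁺⁺ : Valuation F → K → Set
  PersistentOn⁺⁺ V k = ∀ x y → R⁺⁺ k x → R⁺⁺ k y → R x y →
                       ∀ χ → Sat F V x χ → Sat F V y χ

curryAx : Form → Form → Form → Form
curryAx φ ψ θ = ((φ & ψ) ⇒ θ) ⇒ (φ ⇒ (ψ ⇒ θ))

SchemeInModel : (F : Frame) → Valuation F → Set
SchemeInModel F V = ∀ φ ψ θ (k : Frame.K F) → Sat F V k (curryAx φ ψ θ)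

SchemeInFrame : Frame → Set₁
SchemeInFrame F = ∀ (V : Valuation F) → SchemeInModel F V

-- (a) Soundness is checked node by node: unfolding the scheme at k gives nodes
--     k R a R b R c with a ⊨ (φ&ψ)→θ, b ⊨ φ, c ⊨ ψ.  Transitivity on R⁺[k]
--     yields a R c, and persistence on R⁺⁺[k] moves φ from b to c, so c ⊨ θ.
-- (b) Both frame conditions only concern nodes that have an R-predecessor
--     (every node of R⁺[k] has one, every node of R⁺⁺[k] has two in a row).
--     * Transitivity: if w R x, evaluate the instance Top, Top, p at w, where
--       p holds exactly at the R-successors of x; then x R y R z forces x R z.
--     * Persistence: if v R w R x, the instance χ, Top, χ at v (whose
--       antecedent holds trivially at w) carries χ from x to any y with x R y.
module Submission where

open import Defs
open import Data.Product using (_×_; Σ; _,_; proj₁; proj₂)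

Top : Form
Top = fls ⇒ fls

module _ {F : Frame} where
  open Frame F

  top-true : (V : Valuation F) (k : K) → Sat F V k Top
  top-true V k _ _ ()

  predecessor⁺ : ∀ {k x} → R⁺ F k x → Σ K (λ w → R w x)
  predecessor⁺ {k} (step kRx)   = k , kRx
  predecessor⁺ (more {y} _ yRx) = y , yRx

  curry-sound : (V : Valuation F) (k : K) →
                TransOn⁺ F k → PersistentOn⁺⁺ F V k →
                ∀ φ ψ θ → Sat F V k (curryAx φ ψ θ)
  curry-sound V k trans pers φ ψ θ a kRa a⊨φ&ψ⇒θ b aRb b⊨φ c bRc c⊨ψ =
    a⊨φ&ψ⇒θ c aRc (c⊨φ , c⊨ψ)
    where
      k⁺a : R⁺ F k a
      k⁺a = step kRa
      k⁺b : R⁺ F k b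
      k⁺b = more k⁺a aRb
      aRc : R a c
      aRc = trans a b c k⁺a k⁺b (more k⁺b bRc) aRb bRc
      c⊨φ : Sat F V c φ
      c⊨φ = pers b c (a , k⁺a , aRb) (b , k⁺b , bRc) bRc φ b⊨φ

  curry-forces-transitivity : SchemeInFrame F →
                              ∀ {w x y z} → R w x → R x y → R y z → R x z
  curry-forces-transitivity valid {w} {x} {y} {z} wRx xRy yRz =
    valid succ-of-x Top Top (atom 0) w x wRx x⊨Top&Top⇒p
          y xRy (top-true succ-of-x y) z yRz (top-true succ-of-x z)
    where
      succ-of-x : Valuation F
      succ-of-x u _ = R x u
      x⊨Top&Top⇒p : Sat F succ-of-x x ((Top & Top) ⇒ atom 0)
      x⊨Top&Top⇒p u xRu _ = xRu

  curry-forces-persistence : (V : Valuation F) (v : K) →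
                             (∀ φ ψ θ → Sat F V v (curryAx φ ψ θ)) →
                             ∀ {w x y} → R v w → R w x → R x y →
                             ∀ χ → Sat F V x χ → Sat F V y χ
  curry-forces-persistence V v scheme {w} {x} {y} vRw wRx xRy χ x⊨χ =
    scheme χ Top χ w vRw (λ _ _ χ&Top → proj₁ χ&Top) x wRx x⊨χ
           y xRy (top-true V y)

theorem5 : ((F : Frame) (V : Valuation F) →
             (∀ k → TransOn⁺ F k × PersistentOn⁺⁺ F V k) →
             SchemeInModel F V)
           × ((F : Frame) → SchemeInFrame F →
             (∀ k → TransOn⁺ F k)
             × (∀ (V : Valuation F) → SchemeInModel F V → ∀ k → PersistentOn⁺⁺ F V k))
theorem5 = soundness , λ F valid → transitive F valid , persistent F
  where
    soundness : (F : Frame) (V : Valuation F) →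
                (∀ k → TransOn⁺ F k × PersistentOn⁺⁺ F V k) → SchemeInModel F V
    soundness F V conds φ ψ θ k =
      curry-sound V k (proj₁ (conds k)) (proj₂ (conds k)) φ ψ θ

    transitive : (F : Frame) → SchemeInFrame F → ∀ k → TransOn⁺ F k
    transitive F valid k x y z k⁺x _ _ xRy yRz
      with predecessor⁺ k⁺x
    ... | w , wRx = curry-forces-transitivity valid wRx xRy yRz

    persistent : (F : Frame) (V : Valuation F) → SchemeInModel F V →
                 ∀ k → PersistentOn⁺⁺ F V k
    persistent F V scheme k x y (w , k⁺w , wRx) _ xRy
      with predecessor⁺ k⁺w
    ... | v , vRw =
      curry-forces-persistence V v (λ φ ψ θ → scheme φ ψ θ v) vRw wRx xRy
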